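{- Let $\leadsto'$ be the context-reduction relation defined by the same rules as $\leadsto$ except that its weakening rule omits the side condition $x\notin|\Omega_L\Omega_R|$ (so the added hypothesis may already occur in the context). Then for all $\Gamma$, $r$, $\Omega$ (with $\Omega\geq r$ and all hypotheses of $\Omega$ in $\Gamma$), $\{\Omega'\mid \Omega\leadsto'^{\Gamma}_{r}\Omega'\} = \{\Omega'\mid\Omega\leadsto^{\Gamma}_{r}\Omega'\}$.
   Context: Fix a preorder $(\mathcal{M},\geq)$ of modes and, for each mode $m$, a set $\sigma(m)\subseteq\{\mathsf{W},\mathsf{C}^\leftarrow,\mathsf{C}^\rightarrow,\mathsf{M}^\leftarrow,\mathsf{M}^\rightarrow\}$ (weakening, left/right contraction, left/right mobility), monotone: $k\geq m$ implies $\sigma(k)\supseteq\sigma(m)$, and satisfying the closure properties: if $\mathsf{W},\mathsf{C}^\leftarrow\in\sigma(m)$ then $\mathsf{M}^\leftarrow\in\sigma(m)$; if $\mathsf{W},\mathsf{C}^\rightarrow\in\sigma(m)$ then $\mathsf{M}^\rightarrow\in\sigma(m)$. Propositions $A_m$ are indexed by modes. An ordered context $\Omega$ is a finite sequence of labeled hypotheses $x{:}A_m$ (repetitions allowed, each variable always labeling the same proposition); $|\Omega|$ is its set of variables; $\Omega\geq r$ means every $y{:}B_k$ in $\Omega$ has $k\geq r$; $\Omega$ is normal ($\Omega\ \mathsf{nf}$) if no variable occurs twice. $\Gamma$ is an unordered finite set of labeled hypotheses. The relation $\Omega\leadsto^{\Gamma}_{r}\Omega'$ (presupposing $\Omega\subseteq\Gamma$,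 $\Omega\geq r$) is generated by the rules (premise $\Rightarrow$ conclusion): (W) $\Omega_L(x{:}A_m)\Omega_R\leadsto\Omega'$, $\mathsf{W}\in\sigma(m)$, $m\geq r$, $x{:}A_m\in\Gamma$, $x\notin|\Omega_L\Omega_R|\Rightarrow\Omega_L\Omega_R\leadsto\Omega'$; ($\mathsf{C}^\leftarrow$) $\Omega_L(x{:}A_m)\Omega_M\Omega_R\leadsto\Omega'$, $\mathsf{C}^\leftarrow\in\sigma(m)\Rightarrow\Omega_L(x{:}A_m)\Omega_M(x{:}A_m)\Omega_R\leadsto\Omega'$; ($\mathsf{C}^\rightarrow$) $\Omega_L\Omega_M(x{:}A_m)\Omega_R\leadsto\Omega'$, $\mathsf{C}^\rightarrow\in\sigma(m)\Rightarrow\Omega_L(x{:}A_m)\Omega_M(x{:}A_m)\Omega_R\leadsto\Omega'$; ($\mathsf{M}^\leftarrow$) $\Omega_L(x{:}A_m)\Omega_M\Omega_R\leadsto\Omega'$, $\mathsf{M}^\leftarrow\in\sigma(m)\Rightarrow\Omega_L\Omega_M(x{:}A_m)\Omega_R\leadsto\Omega'$; ($\mathsf{M}^\rightarrow$) $\Omega_L\Omega_M(x{:}A_m)\Omega_R\leadsto\Omega'$, $\mathsf{M}^\rightarrow\in\sigma(m)\Rightarrow\Omega_L(x{:}A_m)\Omega_M\Omega_R\leadsto\Omega'$; (id) $\Omega\ \mathsf{nf}\Rightarrow\Omega\leadsto\Omega$. (All arrows carry the same $\Gamma$ and $r$.) -}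

module Defs where

open import Level using (0ℓ)
open import Data.Product using (Σ; _×_; _,_)
open import Data.List using (List; []; _∷_; _++_; map)
open import Data.List.Membership.Propositional using (_∈_; _∉_)
open import Data.List.Relation.Unary.All using (All)
open import Data.List.Relation.Unary.Unique.Propositional using (Unique)
open import Relation.Binary.PropositionalEquality using (_≡_)
open import Relation.Binary.Structures using (IsPreorder)

data Struct : Set where
  W Cˡ Cʳ Mˡ Mʳ : Struct   -- weakening, left/right contraction, left/right mobility

record ModeSystem : Set₁ where
  field
    Mode       : Set
    _≥_        : Mode → Mode → Set
    isPreorder : IsPreorder _≡_ _≥_
    σ          : Mode → Struct → Set          -- σ m s  means  s ∈ σ(m)
    σ-mono     : ∀ {k m s} → k ≥ m → σ m s → σ k s
    σ-closedˡ  : ∀ {m} → σ m W → σ m Cˡ → σ m Mˡ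
    σ-closedʳ  : ∀ {m} → σ m W → σ m Cʳ → σ m Mʳ

module Contexts (𝓜 : ModeSystem) (Prop : ModeSystem.Mode 𝓜 → Set) (Var : Set) where
  open ModeSystem 𝓜

  record Hyp : Set where
    constructor hyp
    field
      var  : Var
      mode : Mode
      prop : Prop mode
  open Hyp public

  -- Ordered contexts Ω are lists of hypotheses; Γ is a finite (unordered) list.
  Ctx : Set
  Ctx = List Hyp

  vars : Ctx → List Var
  vars Ω = map var Ω

  _≥ᶜ_ : Ctx → Mode → Set
  Ω ≥ᶜ r = All (λ h → mode h ≥ r) Ω

  _⊆ᶜ_ : Ctx → Ctx → Set
  Ω ⊆ᶜ Γ = All (_∈ Γ) Ω

  Normal : Ctx → Set
  Normal Ω = Unique (vars Ω)

  Consistent : Ctx → Set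
  Consistent Γ = ∀ {h h′} → h ∈ Γ → h′ ∈ Γ → var h ≡ var h′ → h ≡ h′

  data Reduces (Γ : Ctx) (r : Mode) : Ctx → Ctx → Set where
    red-W  : ∀ ΩL ΩR x {Ω′} →
             Reduces Γ r (ΩL ++ x ∷ ΩR) Ω′ → σ (mode x) W → mode x ≥ r → x ∈ Γ →
             var x ∉ vars (ΩL ++ ΩR) →
             Reduces Γ r (ΩL ++ ΩR) Ω′
    red-Cˡ : ∀ ΩL x ΩM ΩR {Ω′} →
             Reduces Γ r (ΩL ++ x ∷ ΩM ++ ΩR) Ω′ → σ (mode x) Cˡ →
             Reduces Γ r (ΩL ++ x ∷ ΩM ++ x ∷ ΩR) Ω′
    red-Cʳ : ∀ ΩL x ΩM ΩR {Ω′} →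
             Reduces Γ r (ΩL ++ ΩM ++ x ∷ ΩR) Ω′ → σ (mode x) Cʳ →
             Reduces Γ r (ΩL ++ x ∷ ΩM ++ x ∷ ΩR) Ω′
    red-Mˡ : ∀ ΩL x ΩM ΩR {Ω′} →
             Reduces Γ r (ΩL ++ x ∷ ΩM ++ ΩR) Ω′ → σ (mode x) Mˡ →
             Reduces Γ r (ΩL ++ ΩM ++ x ∷ ΩR) Ω′
    red-Mʳ : ∀ ΩL x ΩM ΩR {Ω′} →
             Reduces Γ r (ΩL ++ ΩM ++ x ∷ ΩR) Ω′ → σ (mode x) Mʳ →
             Reduces Γ r (ΩL ++ x ∷ ΩM ++ ΩR) Ω′
    red-id : ∀ {Ω} → Normal Ω → Reduces Γ r Ω Ω

  data Reduces′ (Γ : Ctx) (r : Mode) : Ctx → Ctx → Set where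
    red-W  : ∀ ΩL ΩR x {Ω′} →
             Reduces′ Γ r (ΩL ++ x ∷ ΩR) Ω′ → σ (mode x) W → mode x ≥ r → x ∈ Γ →
             Reduces′ Γ r (ΩL ++ ΩR) Ω′
    red-Cˡ : ∀ ΩL x ΩM ΩR {Ω′} →
             Reduces′ Γ r (ΩL ++ x ∷ ΩM ++ ΩR) Ω′ → σ (mode x) Cˡ →
             Reduces′ Γ r (ΩL ++ x ∷ ΩM ++ x ∷ ΩR) Ω′
    red-Cʳ : ∀ ΩL x ΩM ΩR {Ω′} →
             Reduces′ Γ r (ΩL ++ ΩM ++ x ∷ ΩR) Ω′ → σ (mode x) Cʳ →
             Reduces′ Γ r (ΩL ++ x ∷ ΩM ++ x ∷ ΩR) Ω′
    red-Mˡ : ∀ ΩL x ΩM ΩR {Ω′} →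
             Reduces′ Γ r (ΩL ++ x ∷ ΩM ++ ΩR) Ω′ → σ (mode x) Mˡ →
             Reduces′ Γ r (ΩL ++ ΩM ++ x ∷ ΩR) Ω′
    red-Mʳ : ∀ ΩL x ΩM ΩR {Ω′} →
             Reduces′ Γ r (ΩL ++ ΩM ++ x ∷ ΩR) Ω′ → σ (mode x) Mʳ →
             Reduces′ Γ r (ΩL ++ x ∷ ΩM ++ ΩR) Ω′
    red-id : ∀ {Ω} → Normal Ω → Reduces′ Γ r Ω Ω

-- Every ⇝-derivation is a ⇝′-derivation. Conversely, a ⇝′-weakening whose
-- variable already occurs in the context adds, by consistency of Γ, a second copy
-- of a hypothesis that is already there, so it suffices that ⇝ is closed under
-- deleting such a redundant copy of a weakenable hypothesis. This goes by
-- induction on the derivation: a deletion away from the hypotheses a rule acts on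
-- commutes with the rule; deleting one copy of a contracted pair leaves either the
-- premise or a mobility step (W and C give M by closure of σ); deleting a moved
-- hypothesis is deleting it from the premise; and the identity rule never sees a
-- duplicate because its context is normal.

module Submission where

open import Defs
open import Function.Bundles using (_⇔_; mk⇔)
open import Relation.Binary.Definitions using (DecidableEquality)
open import Data.Product using (∃-syntax; _×_; _,_)
open import Data.Sum using (_⊎_; inj₁; inj₂)
open import Data.Empty using (⊥-elim)
open import Data.List using (List; []; _∷_; _++_)
open import Data.List.Properties using (++-assoc; ++-identityʳ; map-++; ∷-injective)
open import Data.List.Relation.Unary.Any using (here; there)
open import Data.List.Relation.Unary.All as All using ()
open import Data.List.Relation.Unary.AllPairs using (_∷_)
open import Data.List.Relation.Unary.Unique.Propositional using (Unique)
open import Data.List.Membership.Propositional using (_∈_; _∉_)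
open import Data.List.Membership.Propositional.Properties using (∈-++⁺ˡ; ∈-++⁺ʳ; ∈-++⁻; ∈-map⁺; ∈-map⁻)
open import Data.List.Relation.Binary.Permutation.Propositional using (↭-sym)
open import Data.List.Relation.Binary.Permutation.Propositional.Properties using (shift)
open import Data.List.Relation.Binary.Subset.Propositional using (_⊆_)
open import Data.List.Relation.Binary.Subset.Propositional.Properties
  using (⊆-reflexive; ⊆-reflexive-↭; ⊆-trans; ∈-∷⁺ʳ; xs⊆x∷xs; ∷⁺ʳ; ++⁺ʳ; ++⁺ˡ; map⁺)
open import Relation.Binary.PropositionalEquality using (_≡_; refl; sym; trans; cong; subst)
open import Relation.Nullary using (yes; no)

module _ {X : Set} where

  ++-∷-split : ∀ (A B L : List X) x R → A ++ B ≡ L ++ x ∷ R →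
               (∃[ M ] A ≡ L ++ x ∷ M × R ≡ M ++ B) ⊎
               (∃[ M ] L ≡ A ++ M × B ≡ M ++ x ∷ R)
  ++-∷-split []      B L       x R eq   = inj₂ (L , refl , eq)
  ++-∷-split (a ∷ A) B []      x R refl = inj₁ (A , refl , refl)
  ++-∷-split (a ∷ A) B (l ∷ L) x R eq with ∷-injective eq
  ... | refl , eq′ with ++-∷-split A B L x R eq′
  ...   | inj₁ (M , refl , R≡) = inj₁ (M , refl , R≡)
  ...   | inj₂ (M , refl , B≡) = inj₂ (M , refl , B≡)

  ++-∷-locate : ∀ (A : List X) y B L x R → A ++ y ∷ B ≡ L ++ x ∷ R →
                (∃[ M ] A ≡ L ++ x ∷ M × R ≡ M ++ y ∷ B) ⊎
                (L ≡ A × x ≡ y × R ≡ B) ⊎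
                (∃[ M ] L ≡ A ++ y ∷ M × B ≡ M ++ x ∷ R)
  ++-∷-locate A y B L x R eq with ++-∷-split A (y ∷ B) L x R eq
  ... | inj₁ inA                    = inj₁ inA
  ... | inj₂ ([] , L≡A++[] , refl)  = inj₂ (inj₁ (trans L≡A++[] (++-identityʳ A) , refl , refl))
  ... | inj₂ (_ ∷ M , refl , eq′) with ∷-injective eq′
  ...   | refl , B≡ = inj₂ (inj₂ (M , refl , B≡))

  ++-assoc₃ : ∀ (A B C D : List X) → A ++ B ++ C ++ D ≡ (A ++ B ++ C) ++ D
  ++-assoc₃ A B C D = trans (cong (A ++_) (sym (++-assoc B C D))) (sym (++-assoc A (B ++ C) D))

  ++-assoc-middle : ∀ (A B C D : List X) → (A ++ B) ++ C ++ D ≡ A ++ (B ++ C) ++ D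
  ++-assoc-middle A B C D = trans (++-assoc A B (C ++ D)) (cong (A ++_) (sym (++-assoc B C D)))

  ∷-shift-⊆ : ∀ (A : List X) {y B} → A ++ y ∷ B ⊆ y ∷ A ++ B
  ∷-shift-⊆ A {y} {B} = ⊆-reflexive-↭ (shift y A B)

  ∷-unshift-⊆ : ∀ (A : List X) {y B} → y ∷ A ++ B ⊆ A ++ y ∷ B
  ∷-unshift-⊆ A {y} {B} = ⊆-reflexive-↭ (↭-sym (shift y A B))

  redundant-⊆ : ∀ (A : List X) {y B} → y ∈ A ++ B → A ++ y ∷ B ⊆ A ++ B
  redundant-⊆ A y∈ p with ∈-++⁻ A p
  ... | inj₁ q           = ∈-++⁺ˡ q
  ... | inj₂ (here refl) = y∈
  ... | inj₂ (there q)   = ∈-++⁺ʳ A q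

  redundant-before-⊆ : ∀ (A B : List X) {y C} → y ∈ C → (A ++ y ∷ B) ++ C ⊆ (A ++ B) ++ C
  redundant-before-⊆ A B {y} {C} y∈C p =
    ⊆-reflexive (sym (++-assoc A B C))
      (redundant-⊆ A (∈-++⁺ʳ A (∈-++⁺ʳ B y∈C)) (⊆-reflexive (++-assoc A (y ∷ B) C) p))

  Unique-++-∷⇒∉ : ∀ (A : List X) {y B} → Unique (A ++ y ∷ B) → y ∉ A ++ B
  Unique-++-∷⇒∉ []      (y∉B ∷ _) p          = All.lookup y∉B p refl
  Unique-++-∷⇒∉ (a ∷ A) (a∉ ∷ _)  (here refl) = All.lookup a∉ (∈-++⁺ʳ A (here refl)) refl
  Unique-++-∷⇒∉ (a ∷ A) (_ ∷ u)   (there p)   = Unique-++-∷⇒∉ A u p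

module _ (𝓜 : ModeSystem) (Prop : ModeSystem.Mode 𝓜 → Set) (Var : Set) where
  open ModeSystem 𝓜
  open Contexts 𝓜 Prop Var

  module _ (Γ : Ctx) (r : Mode) where

    Reduces-resp-≡ : ∀ {Δ₁ Δ₂ Ω′} → Δ₁ ≡ Δ₂ → Reduces Γ r Δ₁ Ω′ → Reduces Γ r Δ₂ Ω′
    Reduces-resp-≡ refl d = d

    RedundantDroppable : Ctx → Ctx → Set
    RedundantDroppable Δ Ω′ = ∀ L x R → Δ ≡ L ++ x ∷ R → x ∈ L ++ R → σ (mode x) W →
                              Reduces Γ r (L ++ R) Ω′

    droppable-W : ∀ A B y {Ω′} → RedundantDroppable (A ++ y ∷ B) Ω′ →
                  σ (mode y) W → mode y ≥ r → y ∈ Γ → var y ∉ vars (A ++ B) →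
                  RedundantDroppable (A ++ B) Ω′
    droppable-W A B y ih wʸ y≥r y∈Γ fresh L x R eq x∈ wˣ with ++-∷-split A B L x R eq
    ... | inj₁ (M , refl , refl) =
      Reduces-resp-≡ (++-assoc L M B)
        (red-W (L ++ M) B y
          (Reduces-resp-≡ (sym (++-assoc L M (y ∷ B)))
            (ih L x (M ++ y ∷ B) (++-assoc L (x ∷ M) (y ∷ B))
              (++⁺ʳ L (++⁺ʳ M (xs⊆x∷xs B y)) x∈) wˣ))
          wʸ y≥r y∈Γ (λ p → fresh (map⁺ var (++⁺ˡ B (++⁺ʳ L (xs⊆x∷xs M x))) p)))
    ... | inj₂ (M , refl , refl) =
      Reduces-resp-≡ (sym (++-assoc A M R))
        (red-W A (M ++ R) y
          (Reduces-resp-≡ (++-assoc A (y ∷ M) R)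
            (ih (A ++ y ∷ M) x R (sym (++-assoc A (y ∷ M) (x ∷ R)))
              (++⁺ˡ R (++⁺ʳ A (xs⊆x∷xs M y)) x∈) wˣ))
          wʸ y≥r y∈Γ (λ p → fresh (map⁺ var (++⁺ʳ A (++⁺ʳ M (xs⊆x∷xs R x))) p)))

    droppable-Cˡ : ∀ A y B C {Ω′} → Reduces Γ r (A ++ y ∷ B ++ C) Ω′ →
                   RedundantDroppable (A ++ y ∷ B ++ C) Ω′ → σ (mode y) Cˡ →
                   RedundantDroppable (A ++ y ∷ B ++ y ∷ C) Ω′
    droppable-Cˡ A y B C d ih cʸ L x R eq x∈ wˣ with ++-∷-locate A y (B ++ y ∷ C) L x R eq
    ... | inj₁ (M , refl , refl) =
      Reduces-resp-≡ (++-assoc L M (y ∷ B ++ y ∷ C))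
        (red-Cˡ (L ++ M) y B C
          (Reduces-resp-≡ (sym (++-assoc L M (y ∷ B ++ C)))
            (ih L x (M ++ y ∷ B ++ C) (++-assoc L (x ∷ M) (y ∷ B ++ C))
              (++⁺ʳ L (++⁺ʳ M (redundant-⊆ (y ∷ B) (here refl))) x∈) wˣ)) cʸ)
    ... | inj₂ (inj₁ (refl , refl , refl)) = red-Mˡ A y B C d (σ-closedˡ wˣ cʸ)
    ... | inj₂ (inj₂ (M , refl , eq′)) with ++-∷-locate B y C M x R eq′
    ...   | inj₁ (N , refl , refl) =
      Reduces-resp-≡ (sym (++-assoc-middle A (y ∷ M) N (y ∷ C)))
        (red-Cˡ A y (M ++ N) C
          (Reduces-resp-≡ (++-assoc-middle A (y ∷ M) N C)
            (ih (A ++ y ∷ M) x (N ++ C) (sym (++-assoc-middle A (y ∷ M) (x ∷ N) C))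
              (⊆-reflexive (sym (++-assoc-middle A (y ∷ M) N C))
                (++⁺ʳ A (redundant-⊆ (y ∷ M ++ N) (here refl))
                  (⊆-reflexive (++-assoc-middle A (y ∷ M) N (y ∷ C)) x∈))) wˣ)) cʸ)
    ...   | inj₂ (inj₁ (refl , refl , refl)) = Reduces-resp-≡ (sym (++-assoc A (y ∷ B) C)) d
    ...   | inj₂ (inj₂ (N , refl , refl)) =
      Reduces-resp-≡ (++-assoc₃ A (y ∷ B) (y ∷ N) R)
        (red-Cˡ A y B (N ++ R)
          (Reduces-resp-≡ (sym (++-assoc₃ A (y ∷ B) N R))
            (ih (A ++ y ∷ B ++ N) x R (++-assoc₃ A (y ∷ B) N (x ∷ R))
              (++⁺ˡ R (++⁺ʳ A (redundant-⊆ (y ∷ B) (here refl))) x∈) wˣ)) cʸ)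

    droppable-Cʳ : ∀ A y B C {Ω′} → Reduces Γ r (A ++ B ++ y ∷ C) Ω′ →
                   RedundantDroppable (A ++ B ++ y ∷ C) Ω′ → σ (mode y) Cʳ →
                   RedundantDroppable (A ++ y ∷ B ++ y ∷ C) Ω′
    droppable-Cʳ A y B C d ih cʸ L x R eq x∈ wˣ with ++-∷-locate A y (B ++ y ∷ C) L x R eq
    ... | inj₁ (M , refl , refl) =
      Reduces-resp-≡ (++-assoc L M (y ∷ B ++ y ∷ C))
        (red-Cʳ (L ++ M) y B C
          (Reduces-resp-≡ (sym (++-assoc L M (B ++ y ∷ C)))
            (ih L x (M ++ B ++ y ∷ C) (++-assoc L (x ∷ M) (B ++ y ∷ C))
              (++⁺ʳ L (++⁺ʳ M (redundant-⊆ [] (∈-++⁺ʳ B (here refl)))) x∈) wˣ)) cʸ)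
    ... | inj₂ (inj₁ (refl , refl , refl)) = d
    ... | inj₂ (inj₂ (M , refl , eq′)) with ++-∷-locate B y C M x R eq′
    ...   | inj₁ (N , refl , refl) =
      Reduces-resp-≡ (sym (++-assoc-middle A (y ∷ M) N (y ∷ C)))
        (red-Cʳ A y (M ++ N) C
          (Reduces-resp-≡ (++-assoc-middle A M N (y ∷ C))
            (ih (A ++ M) x (N ++ y ∷ C) (sym (++-assoc-middle A M (x ∷ N) (y ∷ C)))
              (redundant-before-⊆ A M (∈-++⁺ʳ N (here refl)) x∈) wˣ)) cʸ)
    ...   | inj₂ (inj₁ (refl , refl , refl)) =
      Reduces-resp-≡ (sym (++-assoc A (y ∷ B) C)) (red-Mʳ A y B C d (σ-closedʳ wˣ cʸ))
    ...   | inj₂ (inj₂ (N , refl , refl)) =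
      Reduces-resp-≡ (++-assoc₃ A (y ∷ B) (y ∷ N) R)
        (red-Cʳ A y B (N ++ R)
          (Reduces-resp-≡ (sym (++-assoc₃ A B (y ∷ N) R))
            (ih (A ++ B ++ y ∷ N) x R (++-assoc₃ A B (y ∷ N) (x ∷ R))
              (++⁺ˡ R (++⁺ʳ A (redundant-⊆ [] (∈-++⁺ʳ B (here refl)))) x∈) wˣ)) cʸ)

    droppable-Mˡ : ∀ A y B C {Ω′} → RedundantDroppable (A ++ y ∷ B ++ C) Ω′ → σ (mode y) Mˡ →
                   RedundantDroppable (A ++ B ++ y ∷ C) Ω′
    droppable-Mˡ A y B C ih mʸ L x R eq x∈ wˣ with ++-∷-split A (B ++ y ∷ C) L x R eq
    ... | inj₁ (M , refl , refl) =
      Reduces-resp-≡ (++-assoc L M (B ++ y ∷ C))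
        (red-Mˡ (L ++ M) y B C
          (Reduces-resp-≡ (sym (++-assoc L M (y ∷ B ++ C)))
            (ih L x (M ++ y ∷ B ++ C) (++-assoc L (x ∷ M) (y ∷ B ++ C))
              (++⁺ʳ L (++⁺ʳ M (∷-shift-⊆ B)) x∈) wˣ)) mʸ)
    ... | inj₂ (M , refl , eq′) with ++-∷-locate B y C M x R eq′
    ...   | inj₁ (N , refl , refl) =
      Reduces-resp-≡ (sym (++-assoc-middle A M N (y ∷ C)))
        (red-Mˡ A y (M ++ N) C
          (Reduces-resp-≡ (++-assoc-middle A (y ∷ M) N C)
            (ih (A ++ y ∷ M) x (N ++ C) (sym (++-assoc-middle A (y ∷ M) (x ∷ N) C))
              (⊆-reflexive (sym (++-assoc-middle A (y ∷ M) N C))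
                (++⁺ʳ A (∷-shift-⊆ (M ++ N))
                  (⊆-reflexive (++-assoc-middle A M N (y ∷ C)) x∈))) wˣ)) mʸ)
    ...   | inj₂ (inj₁ (refl , refl , refl)) =
      Reduces-resp-≡ (sym (++-assoc A B C))
        (ih A y (B ++ C) refl (⊆-reflexive (++-assoc A B C) x∈) wˣ)
    ...   | inj₂ (inj₂ (N , refl , refl)) =
      Reduces-resp-≡ (++-assoc₃ A B (y ∷ N) R)
        (red-Mˡ A y B (N ++ R)
          (Reduces-resp-≡ (sym (++-assoc₃ A (y ∷ B) N R))
            (ih (A ++ y ∷ B ++ N) x R (++-assoc₃ A (y ∷ B) N (x ∷ R))
              (++⁺ˡ R (++⁺ʳ A (∷-shift-⊆ B)) x∈) wˣ)) mʸ)

    droppable-Mʳ : ∀ A y B C {Ω′} → RedundantDroppable (A ++ B ++ y ∷ C) Ω′ → σ (mode y) Mʳ →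
                   RedundantDroppable (A ++ y ∷ B ++ C) Ω′
    droppable-Mʳ A y B C ih mʸ L x R eq x∈ wˣ with ++-∷-locate A y (B ++ C) L x R eq
    ... | inj₁ (M , refl , refl) =
      Reduces-resp-≡ (++-assoc L M (y ∷ B ++ C))
        (red-Mʳ (L ++ M) y B C
          (Reduces-resp-≡ (sym (++-assoc L M (B ++ y ∷ C)))
            (ih L x (M ++ B ++ y ∷ C) (++-assoc L (x ∷ M) (B ++ y ∷ C))
              (++⁺ʳ L (++⁺ʳ M (∷-unshift-⊆ B)) x∈) wˣ)) mʸ)
    ... | inj₂ (inj₁ (refl , refl , refl)) =
      Reduces-resp-≡ (++-assoc A B C)
        (ih (A ++ B) y C (sym (++-assoc A B (y ∷ C))) (⊆-reflexive (sym (++-assoc A B C)) x∈) wˣ)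
    ... | inj₂ (inj₂ (M , refl , eq′)) with ++-∷-split B C M x R eq′
    ...   | inj₁ (N , refl , refl) =
      Reduces-resp-≡ (sym (++-assoc-middle A (y ∷ M) N C))
        (red-Mʳ A y (M ++ N) C
          (Reduces-resp-≡ (++-assoc-middle A M N (y ∷ C))
            (ih (A ++ M) x (N ++ y ∷ C) (sym (++-assoc-middle A M (x ∷ N) (y ∷ C)))
              (⊆-reflexive (sym (++-assoc-middle A M N (y ∷ C)))
                (++⁺ʳ A (∷-unshift-⊆ (M ++ N))
                  (⊆-reflexive (++-assoc-middle A (y ∷ M) N C) x∈))) wˣ)) mʸ)
    ...   | inj₂ (N , refl , refl) =
      Reduces-resp-≡ (++-assoc₃ A (y ∷ B) N R)
        (red-Mʳ A y B (N ++ R)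
          (Reduces-resp-≡ (sym (++-assoc₃ A B (y ∷ N) R))
            (ih (A ++ B ++ y ∷ N) x R (++-assoc₃ A B (y ∷ N) (x ∷ R))
              (++⁺ˡ R (++⁺ʳ A (∷-unshift-⊆ B)) x∈) wˣ)) mʸ)

    normal⇒droppable : ∀ {Δ Ω′} → Normal Δ → RedundantDroppable Δ Ω′
    normal⇒droppable nf L x R refl x∈ _ =
      ⊥-elim (Unique-++-∷⇒∉ (vars L) (subst Unique (map-++ var L (x ∷ R)) nf)
                (subst (var x ∈_) (map-++ var L R) (∈-map⁺ var x∈)))

    reduces⇒droppable : ∀ {Δ Ω′} → Reduces Γ r Δ Ω′ → RedundantDroppable Δ Ω′
    reduces⇒droppable (red-W A B y d wʸ y≥r y∈Γ fresh) =
      droppable-W A B y (reduces⇒droppable d) wʸ y≥r y∈Γ fresh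
    reduces⇒droppable (red-Cˡ A y B C d c) = droppable-Cˡ A y B C d (reduces⇒droppable d) c
    reduces⇒droppable (red-Cʳ A y B C d c) = droppable-Cʳ A y B C d (reduces⇒droppable d) c
    reduces⇒droppable (red-Mˡ A y B C d m) = droppable-Mˡ A y B C (reduces⇒droppable d) m
    reduces⇒droppable (red-Mʳ A y B C d m) = droppable-Mʳ A y B C (reduces⇒droppable d) m
    reduces⇒droppable (red-id nf) = normal⇒droppable nf

  reduces⇒reduces′ : ∀ {Γ r Δ Ω′} → Reduces Γ r Δ Ω′ → Reduces′ Γ r Δ Ω′
  reduces⇒reduces′ (red-W A B x d wˣ x≥r x∈Γ _) = Reduces′.red-W A B x (reduces⇒reduces′ d) wˣ x≥r x∈Γ
  reduces⇒reduces′ (red-Cˡ A y B C d c) = Reduces′.red-Cˡ A y B C (reduces⇒reduces′ d) c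
  reduces⇒reduces′ (red-Cʳ A y B C d c) = Reduces′.red-Cʳ A y B C (reduces⇒reduces′ d) c
  reduces⇒reduces′ (red-Mˡ A y B C d m) = Reduces′.red-Mˡ A y B C (reduces⇒reduces′ d) m
  reduces⇒reduces′ (red-Mʳ A y B C d m) = Reduces′.red-Mʳ A y B C (reduces⇒reduces′ d) m
  reduces⇒reduces′ (red-id nf) = Reduces′.red-id nf

  module _ (_≟_ : DecidableEquality Var) {Γ : Ctx} {r : Mode} (consistent : Consistent Γ) where
    open import Data.List.Membership.DecPropositional _≟_ using (_∈?_)

    reduces′⇒reduces : ∀ {Δ Ω′} → Δ ⊆ Γ → Reduces′ Γ r Δ Ω′ → Reduces Γ r Δ Ω′
    reduces′⇒reduces Δ⊆Γ (Reduces′.red-W A B x d wˣ x≥r x∈Γ)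
      with reduces′⇒reduces (⊆-trans (∷-shift-⊆ A) (∈-∷⁺ʳ x∈Γ Δ⊆Γ)) d | var x ∈? vars (A ++ B)
    ... | d′ | no fresh = red-W A B x d′ wˣ x≥r x∈Γ fresh
    ... | d′ | yes clash with ∈-map⁻ var clash
    ...   | h , h∈ , x≡h with consistent (Δ⊆Γ h∈) x∈Γ (sym x≡h)
    ...     | refl = reduces⇒droppable Γ r d′ A h B refl h∈ wˣ
    reduces′⇒reduces Δ⊆Γ (Reduces′.red-Cˡ A y B C d c) =
      red-Cˡ A y B C (reduces′⇒reduces (⊆-trans (++⁺ʳ A (∷⁺ʳ y (++⁺ʳ B (xs⊆x∷xs C y)))) Δ⊆Γ) d) c
    reduces′⇒reduces Δ⊆Γ (Reduces′.red-Cʳ A y B C d c) =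
      red-Cʳ A y B C (reduces′⇒reduces (⊆-trans (++⁺ʳ A (xs⊆x∷xs _ y)) Δ⊆Γ) d) c
    reduces′⇒reduces Δ⊆Γ (Reduces′.red-Mˡ A y B C d m) =
      red-Mˡ A y B C (reduces′⇒reduces (⊆-trans (++⁺ʳ A (∷-unshift-⊆ B)) Δ⊆Γ) d) m
    reduces′⇒reduces Δ⊆Γ (Reduces′.red-Mʳ A y B C d m) =
      red-Mʳ A y B C (reduces′⇒reduces (⊆-trans (++⁺ʳ A (∷-shift-⊆ B)) Δ⊆Γ) d) m
    reduces′⇒reduces Δ⊆Γ (Reduces′.red-id nf) = red-id nf

theorem6 : (𝓜 : ModeSystem) (Prop : ModeSystem.Mode 𝓜 → Set)
           (Var : Set) → DecidableEquality Var →
           let open ModeSystem 𝓜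
               open Contexts 𝓜 Prop Var
           in (Γ : Ctx) (r : Mode) (Ω : Ctx) →
              Consistent Γ → Ω ≥ᶜ r → Ω ⊆ᶜ Γ →
              (Ω′ : Ctx) → Reduces′ Γ r Ω Ω′ ⇔ Reduces Γ r Ω Ω′
theorem6 𝓜 Prop Var _≟_ Γ r Ω consistent _ Ω⊆Γ Ω′ =
  mk⇔ (reduces′⇒reduces 𝓜 Prop Var _≟_ consistent (All.lookup Ω⊆Γ))
      (reduces⇒reduces′ 𝓜 Prop Var)
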